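{- Let $G$ be a connected graph on $n$ vertices, and let $G^*$ be the graph constructed from $G$ as described in the context. If $G^*$ admits a neighbor-locating $(n+3)$-coloring, then $G$ admits a proper $3$-coloring.
   Context: Construction of $G^*$: let $G$ have vertices $u_1,\dots,u_n$. Add new vertices $u'_1,\dots,u'_n$ and, for every edge $u_iu_j$ of $G$, add the edges $u'_iu'_j$, $u'_iu_j$ and $u_iu'_j$. For each $i\in\{1,\dots,n\}$ add a gadget $X_i$ consisting of a vertex $x_i$ and two independent sets $A_i=\{x_{i,1},\dots,x_{i,n-1}\}$ and $B_i=\{x'_{i,1},\dots,x'_{i,n+2}\}$, with $x_i$ adjacent to every vertex of $A_i\cup B_i$; also make $u_i$ and $u'_i$ adjacent to every vertex of $A_i$. Finally add an independent set $Y=\{y_1,y_2,y_3\}$ and make each $y_j$ adjacent to every vertex of $A_i$ and to $x_i$, for all $i$. There are no other edges. For a proper coloring $f$ and a vertex $x$, $N_f(x)=\{f(y): y \text{ adjacent to } x\}$; $f$ is a neighbor-locating $k$-coloring if it is a proper $k$-coloring and for any two distinct vertices $x,y$, $f(x)\ne f(y)$ or $N_f(x)\ne N_f(y)$. -}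

module Defs where

open import Data.Nat using (ℕ; _+_; _∸_)
open import Data.Fin using (Fin)
open import Data.Product using (Σ; ∃; _×_)
open import Data.Sum using (_⊎_)
open import Relation.Nullary using (¬_)
open import Relation.Binary.PropositionalEquality using (_≡_; _≢_)
open import Function.Bundles using (_⇔_)

record Graph (n : ℕ) : Set₁ where
  field
    Adj     : Fin n → Fin n → Set
    sym     : ∀ {i j} → Adj i j → Adj j i
    irrefl  : ∀ {i} → ¬ Adj i i
open Graph public

data Walk {n : ℕ} (G : Graph n) : Fin n → Fin n → Set where
  here : ∀ {i} → Walk G i i
  step : ∀ {i j k} → Adj G i j → Walk G j k → Walk G i k

Connected : ∀ {n} → Graph n → Set
Connected {n} G = ∀ (i j : Fin n) → Walk G i j

Proper : {V : Set} (A : V → V → Set) (k : ℕ) → (V → Fin k) → Set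
Proper A k f = ∀ {v w} → A v w → f v ≢ f w

InNbhdColours : {V : Set} (A : V → V → Set) {k : ℕ} → (V → Fin k) → V → Fin k → Set
InNbhdColours {V} A f v c = Σ V (λ w → A v w × f w ≡ c)

SameNbhdColours : {V : Set} (A : V → V → Set) {k : ℕ} → (V → Fin k) → V → V → Set
SameNbhdColours A {k} f v w = ∀ (c : Fin k) → InNbhdColours A f v c ⇔ InNbhdColours A f w c

NeighborLocating : {V : Set} (A : V → V → Set) (k : ℕ) → (V → Fin k) → Set
NeighborLocating {V} A k f =
  Proper A k f ×
  (∀ (v w : V) → v ≢ w → f v ≡ f w → ¬ SameNbhdColours A f v w)

Colourable : ∀ {n} → Graph n → ℕ → Set
Colourable {n} G k = Σ (Fin n → Fin k) (Proper (Adj G) k)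

data Vert* (n : ℕ) : Set where
  u   : Fin n → Vert* n
  u'  : Fin n → Vert* n
  x   : Fin n → Vert* n
  a   : Fin n → Fin (n ∸ 1) → Vert* n      -- x_{i,j} ∈ A_i
  b   : Fin n → Fin (n + 2) → Vert* n      -- x'_{i,j} ∈ B_i
  y   : Fin 3 → Vert* n

-- generating (one-directional) edges of G*
data Edge* {n : ℕ} (G : Graph n) : Vert* n → Vert* n → Set where
  uu   : ∀ {i j} → Adj G i j → Edge* G (u i) (u j)
  u'u' : ∀ {i j} → Adj G i j → Edge* G (u' i) (u' j)
  u'u  : ∀ {i j} → Adj G i j → Edge* G (u' i) (u j)
  uu'  : ∀ {i j} → Adj G i j → Edge* G (u i) (u' j)
  xa   : ∀ i j → Edge* G (x i) (a i j)
  xb   : ∀ i j → Edge* G (x i) (b i j)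
  ua   : ∀ i j → Edge* G (u i) (a i j)
  u'a  : ∀ i j → Edge* G (u' i) (a i j)
  ya   : ∀ l i j → Edge* G (y l) (a i j)
  yx   : ∀ l i → Edge* G (y l) (x i)

Adj* : ∀ {n} → Graph n → Vert* n → Vert* n → Set
Adj* G v w = Edge* G v w ⊎ Edge* G w v

{-# OPTIONS --safe #-}
-- For each i, the n - 1 vertices of A_i are pairwise twins, so are the three vertices of Y, and
-- so are u_i and u'_i; in a neighbor-locating colouring twins get distinct colours.  Every vertex
-- of A_i sees Y, u_i and u'_i, so A_i ∪ Y ∪ {u_i, u'_i} would need n + 4 colours unless u_i or
-- u'_i repeats the colour of some y_l.  Colouring i by that l is proper on G, because the copies
-- of adjacent vertices of G are adjacent in G*.
module Submission where

open import Defs hiding (sym)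
open import Data.Nat as ℕ using (ℕ; zero; suc; _+_)
open import Data.Nat.Properties using (+-suc; +-monoʳ-<; n<1+n)
open import Data.Fin using (Fin; zero; suc; splitAt; join; _≟_)
open import Data.Fin.Properties using (join-splitAt; <⇒notInjective; any?)
open import Data.Vec.Functional using (_∷_; [])
open import Data.Product using (Σ; ∃; _,_; proj₁; proj₂)
open import Data.Sum using (_⊎_; inj₁; inj₂; [_,_])
open import Data.Empty using (⊥-elim)
open import Function using (_∘_)
open import Function.Bundles using (_⇔_; mk⇔; Equivalence)
open import Function.Definitions using (Injective)
open import Relation.Nullary using (¬_; yes; no; contradiction)
open import Relation.Unary using (Decidable)
open import Relation.Binary.PropositionalEquality
  using (_≡_; _≢_; refl; sym; trans; cong; subst; module ≡-Reasoning)

open Equivalence using (to; from)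

[,]-injective : {A B C : Set} {f : A → C} {g : B → C} →
                Injective _≡_ _≡_ f → Injective _≡_ _≡_ g → (∀ s t → f s ≢ g t) →
                Injective _≡_ _≡_ [ f , g ]
[,]-injective f-inj g-inj f≢g {inj₁ s} {inj₁ s′} e = cong inj₁ (f-inj e)
[,]-injective f-inj g-inj f≢g {inj₁ s} {inj₂ t}  e = contradiction e (f≢g s t)
[,]-injective f-inj g-inj f≢g {inj₂ t} {inj₁ s}  e = contradiction (sym e) (f≢g s t)
[,]-injective f-inj g-inj f≢g {inj₂ t} {inj₂ t′} e = cong inj₂ (g-inj e)

splitAt-injective : ∀ m {n} → Injective _≡_ _≡_ (splitAt m {n})
splitAt-injective m {n} {i} {j} e = begin
  i                      ≡⟨ sym (join-splitAt m n i) ⟩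
  join m n (splitAt m i) ≡⟨ cong (join m n) e ⟩
  join m n (splitAt m j) ≡⟨ join-splitAt m n j ⟩
  j                      ∎
  where open ≡-Reasoning

<⇒notInjective-⊎ : ∀ {m p k} → k ℕ.< m + p → (h : Fin m ⊎ Fin p → Fin k) →
                   ¬ Injective _≡_ _≡_ h
<⇒notInjective-⊎ {m} k<m+p h h-inj = <⇒notInjective k<m+p (splitAt-injective m ∘ h-inj)

Twins : {V : Set} → (V → V → Set) → V → V → Set
Twins {V} A v w = ∀ (z : V) → A v z ⇔ A w z

module NeighborLocatingColouring {V : Set} {A : V → V → Set} {k : ℕ} {f : V → Fin k}
                                 (nl : NeighborLocating A k f) where

  proper : Proper A k f
  proper = proj₁ nl

  twins-coloured-apart : ∀ {v w} → v ≢ w → Twins A v w → f v ≢ f w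
  twins-coloured-apart {v} {w} v≢w twins fv≡fw = proj₂ nl v w v≢w fv≡fw same
    where
    same : SameNbhdColours A f v w
    same c = mk⇔ (λ (z , vz , e) → z , to (twins z) vz , e)
                 (λ (z , wz , e) → z , from (twins z) wz , e)

  twin-family-injective : ∀ {p} (h : Fin p → V) → Injective _≡_ _≡_ h →
                          (∀ i j → Twins A (h i) (h j)) → Injective _≡_ _≡_ (f ∘ h)
  twin-family-injective h h-inj twins {i} {j} e with i ≟ j
  ... | yes i≡j = i≡j
  ... | no  i≢j = contradiction e (twins-coloured-apart (i≢j ∘ h-inj) (twins i j))

module _ {n : ℕ} (G : Graph n) where

  copy : Fin n → Fin 2 → Vert* n
  copy i = u i ∷ u' i ∷ []

  copy-injective : ∀ i → Injective _≡_ _≡_ (copy i)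
  copy-injective i {zero}     {zero}     _ = refl
  copy-injective i {suc zero} {suc zero} _ = refl
  copy-injective i {zero}     {suc zero} ()
  copy-injective i {suc zero} {zero}     ()

  copies-adjacent : ∀ {i j} → Adj G i j → ∀ s t → Adj* G (copy i s) (copy j t)
  copies-adjacent ij zero       zero       = inj₁ (uu ij)
  copies-adjacent ij zero       (suc zero) = inj₁ (uu' ij)
  copies-adjacent ij (suc zero) zero       = inj₁ (u'u ij)
  copies-adjacent ij (suc zero) (suc zero) = inj₁ (u'u' ij)

  A-twins : ∀ i j j′ → Twins (Adj* G) (a i j) (a i j′)
  A-twins i j j′ _ = mk⇔ (transfer j′) (transfer j)
    where
    transfer : ∀ {j} j′ {z} → Adj* G (a i j) z → Adj* G (a i j′) z
    transfer j′ (inj₂ (xa _ _))   = inj₂ (xa i j′)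
    transfer j′ (inj₂ (ua _ _))   = inj₂ (ua i j′)
    transfer j′ (inj₂ (u'a _ _))  = inj₂ (u'a i j′)
    transfer j′ (inj₂ (ya l _ _)) = inj₂ (ya l i j′)

  Y-twins : ∀ l l′ → Twins (Adj* G) (y l) (y l′)
  Y-twins l l′ _ = mk⇔ (transfer l′) (transfer l)
    where
    transfer : ∀ {l} l′ {z} → Adj* G (y l) z → Adj* G (y l′) z
    transfer l′ (inj₁ (ya _ i j)) = inj₁ (ya l′ i j)
    transfer l′ (inj₁ (yx _ i))   = inj₁ (yx l′ i)

  copy-twins : ∀ i s t → Twins (Adj* G) (copy i s) (copy i t)
  copy-twins i s t _ = mk⇔ (transfer s t) (transfer t s)
    where
    transfer : ∀ s t {z} → Adj* G (copy i s) z → Adj* G (copy i t) z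
    transfer zero       zero       e              = e
    transfer (suc zero) (suc zero) e              = e
    transfer zero       (suc zero) (inj₁ (uu ij))  = inj₁ (u'u ij)
    transfer zero       (suc zero) (inj₁ (uu' ij)) = inj₁ (u'u' ij)
    transfer zero       (suc zero) (inj₁ (ua _ j)) = inj₁ (u'a i j)
    transfer zero       (suc zero) (inj₂ (uu ij))  = inj₂ (uu' ij)
    transfer zero       (suc zero) (inj₂ (u'u ij)) = inj₂ (u'u' ij)
    transfer (suc zero) zero (inj₁ (u'u' ij))      = inj₁ (uu' ij)
    transfer (suc zero) zero (inj₁ (u'u ij))       = inj₁ (uu ij)
    transfer (suc zero) zero (inj₁ (u'a _ j))      = inj₁ (ua i j)
    transfer (suc zero) zero (inj₂ (uu' ij))       = inj₂ (uu ij)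
    transfer (suc zero) zero (inj₂ (u'u' ij))      = inj₂ (u'u ij)

module _ {m : ℕ} {G : Graph (suc m)} {f : Vert* (suc m) → Fin (suc m + 3)}
         (nl : NeighborLocating (Adj* G) (suc m + 3) f) where
  open NeighborLocatingColouring nl

  HasYColour : Vert* (suc m) → Set
  HasYColour v = ∃ λ l → f v ≡ f (y l)

  hasYColour? : Decidable HasYColour
  hasYColour? v = any? (λ l → f v ≟ f (y l))

  some-copy-has-Y-colour : ∀ i → ∃ λ s → HasYColour (copy G i s)
  some-copy-has-Y-colour i with any? (hasYColour? ∘ copy G i)
  ... | yes found = found
  ... | no  none  = ⊥-elim (<⇒notInjective-⊎ m+4<m+5 colours colours-injective)
    where
    m+4<m+5 : suc m + 3 ℕ.< m + 5
    m+4<m+5 = subst (ℕ._< m + 5) (+-suc m 3) (+-monoʳ-< m (n<1+n 4))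

    YCopyColours : Fin 3 ⊎ Fin 2 → Fin (suc m + 3)
    YCopyColours = [ f ∘ y , f ∘ copy G i ]

    YCopyColours-injective : Injective _≡_ _≡_ YCopyColours
    YCopyColours-injective =
      [,]-injective (twin-family-injective y (λ { refl → refl }) (Y-twins G))
                    (twin-family-injective (copy G i) (copy-injective G i) (copy-twins G i))
                    (λ l s e → none (s , l , sym e))

    A-avoids-YCopyColours : ∀ j t → f (a i j) ≢ YCopyColours t
    A-avoids-YCopyColours j (inj₁ l)          = proper (inj₂ (ya l i j))
    A-avoids-YCopyColours j (inj₂ zero)       = proper (inj₂ (ua i j))
    A-avoids-YCopyColours j (inj₂ (suc zero)) = proper (inj₂ (u'a i j))

    colours : Fin m ⊎ Fin 5 → Fin (suc m + 3)
    colours = [ f ∘ a i , YCopyColours ∘ splitAt 3 ]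

    colours-injective : Injective _≡_ _≡_ colours
    colours-injective =
      [,]-injective (twin-family-injective (a i) (λ { refl → refl }) (A-twins G i))
                    (splitAt-injective 3 ∘ YCopyColours-injective)
                    (λ j t → A-avoids-YCopyColours j (splitAt 3 t))

  Y-index : Fin (suc m) → Fin 3
  Y-index i = proj₁ (proj₂ (some-copy-has-Y-colour i))

  Y-index-proper : Proper (Adj G) 3 Y-index
  Y-index-proper {i} {j} ij same with some-copy-has-Y-colour i | some-copy-has-Y-colour j
  ... | s , l , fs≡fl | t , l′ , ft≡fl′ =
    proper (copies-adjacent G ij s t) (trans fs≡fl (trans (cong (f ∘ y) same) (sym ft≡fl′)))

lemma6 : (n : ℕ) (G : Graph n) → Connected G →
    Σ (Vert* n → Fin (n + 3)) (NeighborLocating (Adj* G) (n + 3)) →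
    Colourable G 3
lemma6 zero    _ _ _        = (λ ()) , λ { {()} }
lemma6 (suc m) G _ (f , nl) = Y-index nl , Y-index-proper nl
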